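{- Let $\mathcal G$ be a class of graphs. Then there exist integers $d,m$ such that $\mathcal G\subseteq\mathrm{TM}_d^m$ if and only if there exists an integer $k$ such that $\mathcal G\subseteq\mathrm{SC}_k$. More precisely, for all non-negative integers $d,m,k$: $\mathrm{TM}_d^m\subseteq \mathrm{SC}_{dm(m+1)}$ and $\mathrm{SC}_k\subseteq\mathrm{TM}_k^{2^k}$.
   Context: All graphs are finite, simple and undirected. A tree-model of $m$ colours and depth $d$ of a graph $G$ is a rooted tree $T$ with a set $S\subseteq\{1,\dots,m\}^2\times\{1,\dots,d\}$ such that: every root-to-leaf path of $T$ has length exactly $d$; the leaves of $T$ are exactly $V(G)$; each leaf gets one of the colours $1,\dots,m$; $(i,j,\ell)\in S$ iff $(j,i,\ell)\in S$; and for distinct $u,v\in V(G)$ coloured $i,j$ at distance $2\ell$ in $T$, $uv\in E(G)$ iff $(i,j,\ell)\in S$. $\mathrm{TM}_d^m$ is the class of graphs having such a tree-model. For a graph $G$ and $X\subseteq V(G)$, $\overline{G}^X$ is the graph on $V(G)$ in which distinct $x,y$ are adjacent iff either $xy\in E(G)$ and $\{x,y\}\not\subseteq X$, or $xy\notin E(G)$ and $\{x,y\}\subseteq X$. The classes $\mathrm{SC}_n$ are defined inductively: $\mathrm{SC}_0=\{K_1\}$; if $G_1,\dots,G_p\in\mathrm{SC}_n$ ($p\ge1$), $H$ is their disjoint union, and $X\subseteq V(H)$, then $\overline{H}^X\in\mathrm{SC}_{n+1}$. -}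

module Defs where

open import Data.Nat using (ℕ; zero; suc; _+_)
open import Data.Bool using (Bool; true; false; _∧_; _xor_; not)
open import Data.Bool.Properties using (∧-comm)
open import Data.Fin using (Fin; splitAt; _≟_)
open import Data.Sum using (_⊎_; inj₁; inj₂)
open import Data.Product using (Σ; _,_)
open import Data.Unit using (⊤)
open import Data.List using (List; []; _∷_)
open import Data.List.Relation.Unary.All using (All)
open import Relation.Nullary using (yes; no; does)
open import Relation.Binary.PropositionalEquality using (_≡_; _≢_; refl; cong₂; sym)
open import Function.Bundles using (_↔_; Inverse)

record Graph : Set where
  field
    n      : ℕ
    adj    : Fin n → Fin n → Bool
    adj-sym    : ∀ u v → adj u v ≡ adj v u
    adj-irrefl : ∀ u → adj u u ≡ false
open Graph public

record Iso (G H : Graph) : Set where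
  field
    bij      : Fin (n G) ↔ Fin (n H)
    preserve : ∀ u v → adj H (Inverse.to bij u) (Inverse.to bij v) ≡ adj G u v

⊕adj : ∀ {a b} → (Fin a → Fin a → Bool) → (Fin b → Fin b → Bool)
     → Fin a ⊎ Fin b → Fin a ⊎ Fin b → Bool
⊕adj f g (inj₁ x) (inj₁ y) = f x y
⊕adj f g (inj₂ x) (inj₂ y) = g x y
⊕adj f g (inj₁ _) (inj₂ _) = false
⊕adj f g (inj₂ _) (inj₁ _) = false

_⊕_ : Graph → Graph → Graph
G ⊕ H = record
  { n = n G + n H
  ; adj = λ u v → ⊕adj (adj G) (adj H) (splitAt (n G) u) (splitAt (n G) v)
  ; adj-sym = λ u v → s (splitAt (n G) u) (splitAt (n G) v)
  ; adj-irrefl = λ u → i (splitAt (n G) u)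
  }
  where
  s : ∀ x y → ⊕adj (adj G) (adj H) x y ≡ ⊕adj (adj G) (adj H) y x
  s (inj₁ x) (inj₁ y) = adj-sym G x y
  s (inj₂ x) (inj₂ y) = adj-sym H x y
  s (inj₁ _) (inj₂ _) = refl
  s (inj₂ _) (inj₁ _) = refl
  i : ∀ x → ⊕adj (adj G) (adj H) x x ≡ false
  i (inj₁ x) = adj-irrefl G x
  i (inj₂ x) = adj-irrefl H x

⨁ : Graph → List Graph → Graph
⨁ G []       = G
⨁ G (H ∷ Hs) = G ⊕ ⨁ H Hs

private
  ≟-sym : ∀ {k} (u v : Fin k) → does (u ≟ v) ≡ does (v ≟ u)
  ≟-sym u v with u ≟ v | v ≟ u
  ... | yes _ | yes _ = refl
  ... | no _  | no _  = refl
  ... | yes refl | no ne = Data.Empty.⊥-elim (ne refl)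
    where import Data.Empty
  ... | no ne | yes refl = Data.Empty.⊥-elim (ne refl)
    where import Data.Empty

  ≟-refl : ∀ {k} (u : Fin k) → does (u ≟ u) ≡ true
  ≟-refl u with u ≟ u
  ... | yes _ = refl
  ... | no ne = Data.Empty.⊥-elim (ne refl)
    where import Data.Empty

  x∧false : ∀ b → b ∧ false ≡ false
  x∧false false = refl
  x∧false true  = refl

complementOn : (G : Graph) → (Fin (n G) → Bool) → Graph
complementOn G X = record
  { n = n G
  ; adj = λ u v → adj G u v xor (X u ∧ X v ∧ not (does (u ≟ v)))
  ; adj-sym = λ u v → cong₂ _xor_ (adj-sym G u v) (s u v)
  ; adj-irrefl = λ u → irr u
  }
  where
  s : ∀ u v → (X u ∧ X v ∧ not (does (u ≟ v))) ≡ (X v ∧ X u ∧ not (does (v ≟ u)))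
  s u v with X u | X v | does (u ≟ v) | does (v ≟ u) | ≟-sym u v
  ... | false | false | _ | _ | _ = refl
  ... | false | true  | _ | _ | _ = refl
  ... | true  | false | _ | _ | _ = refl
  ... | true  | true  | b | .b | refl = refl
  irr : ∀ u → (adj G u u xor (X u ∧ X u ∧ not (does (u ≟ u)))) ≡ false
  irr u rewrite adj-irrefl G u | ≟-refl u | x∧false (X u) | x∧false (X u) = refl

data SC : ℕ → Graph → Set where
  sc-base : ∀ G → n G ≡ 1 → SC zero G
  sc-step : ∀ {k} G (G₀ : Graph) (Gs : List Graph)
          → SC k G₀ → All (SC k) Gs
          → (X : Fin (n (⨁ G₀ Gs)) → Bool)
          → Iso (complementOn (⨁ G₀ Gs) X) G
          → SC (suc k) G

data Tree : ℕ → Set where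
  leaf : Tree zero
  node : ∀ {d} (k : ℕ) → (Fin (suc k) → Tree d) → Tree (suc d)   -- k+1 ≥ 1 children

Leaf : ∀ {d} → Tree d → Set
Leaf leaf       = ⊤
Leaf (node k f) = Σ (Fin (suc k)) λ i → Leaf (f i)

-- half of the distance in T between two leaves (d minus depth of their lowest common ancestor)
halfDist : ∀ {d} (t : Tree d) → Leaf t → Leaf t → ℕ
halfDist leaf _ _ = 0
halfDist {suc d} (node k f) (i , x) (j , y) with i ≟ j
... | yes refl = halfDist (f i) x y
... | no _     = suc d

record TM (d m : ℕ) (G : Graph) : Set where
  field
    T       : Tree d
    leaves  : Leaf T ↔ Fin (n G)
    colour  : Fin (n G) → Fin m
    S       : Fin m → Fin m → ℕ → Bool       -- (i , j , ℓ) ∈ S  iff  S i j ℓ ≡ true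
    S-sym   : ∀ i j ℓ → S i j ℓ ≡ S j i ℓ
    correct : ∀ u v → u ≢ v →
              adj G u v ≡ S (colour u) (colour v)
                            (halfDist T (Inverse.from leaves u) (Inverse.from leaves v))

module Submission where

-- Both inclusions go through one intermediate notion, a *bit-model* of G
-- over a tree t of depth d with r bits: the leaves of t are V(G), every
-- vertex carries a vector of r bits, and two vertices whose leaves are at
-- distance 2ℓ in t are adjacent iff the GF(2) inner product of their bit
-- vectors, restricted to the positions ≥ ℓ, is 1 (positions are numbered
-- r, …, 1 from the head).  The argument is:
--   * SC_k ⊆ bit-models of depth k with k bits: a disjoint union hangs the
--     models below a new root, and complementing inside X adds one bit that
--     is active at every distance (sc→model);
--   * conversely such a model is peeled: its top bit is the set X, and the
--     children of the root give the components of the union (model→SC);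
--   * a bit-model with k bits is a tree-model with 2^k colours, the colour
--     being the bit vector itself (model→TM);
--   * a tree-model with m colours becomes a bit-model after replacing every
--     tree level by gramDim(m)+1 levels, gramDim(m) = m(m+1)/2, because every
--     symmetric m × m Boolean matrix is a GF(2) Gram matrix of vectors of
--     length gramDim(m) (tm→model); the depth bound
--     d(gramDim(m)+1) ≤ dm(m+1) and monotonicity of SC_k finish the proof.

open import Defs
open import Data.Nat using (ℕ; zero; suc; _+_; _*_; _^_; _≤_; _<_; _≤?_; z≤n; s≤s; _≤′_; ≤′-reflexive; ≤′-step)
open import Data.Nat.Properties using (≤-refl; ≤-trans; n≤1+n; m≤n+m; +-mono-≤; +-monoˡ-≤; +-monoʳ-≤; +-suc; *-suc; *-assoc; +-comm; m≤n⇒m<n∨m≡n; <⇒≱; ≤⇒≤′; module ≤-Reasoning)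
open import Data.Bool using (Bool; true; false; _∧_; _xor_; not)
open import Data.Bool.Properties using (∧-comm; ∧-assoc; ∧-idem; ∧-zeroʳ; ∧-identityʳ; xor-assoc; xor-comm; xor-identityʳ)
open import Data.Fin using (Fin; zero; suc; splitAt; join; _≟_)
open import Data.Fin.Properties using (splitAt-join; +↔⊎; *↔×; 2↔Bool; ¬Fin0)
open import Data.Vec using (Vec; []; _∷_; _++_; head; tail; tabulate; replicate)
open import Data.Sum using (_⊎_; inj₁; inj₂; [_,_]′)
import Data.Sum as Sum
open import Data.Sum.Function.Propositional using (_⊎-↔_)
open import Data.Product using (Σ; _×_; _,_; proj₂)
open import Data.Product.Function.NonDependent.Propositional using (_×-↔_)
open import Data.Unit using (⊤; tt)
open import Data.Empty using (⊥-elim)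
open import Data.List using (List; []; _∷_)
open import Data.List.Relation.Unary.All using (All; []; _∷_)
open import Relation.Nullary using (yes; no; does)
open import Relation.Nullary.Decidable using (dec-true; dec-false)
open import Relation.Binary.PropositionalEquality
open import Function.Bundles using (_⇔_; _↔_; Inverse; mk↔ₛ′; mk⇔)
open import Function.Properties.Inverse using (↔-refl; ↔-sym; ↔-trans)
open Inverse using (to; from)

module _ {A B : Set} (I : A ↔ B) where

  to-from : ∀ y → to I (from I y) ≡ y
  to-from = Inverse.strictlyInverseˡ I

  from-to : ∀ x → from I (to I x) ≡ x
  from-to = Inverse.strictlyInverseʳ I

  to-injective : ∀ {x y} → to I x ≡ to I y → x ≡ y
  to-injective {x} {y} e = trans (sym (from-to x)) (trans (cong (from I) e) (from-to y))

  from-injective : ∀ {x y} → from I x ≡ from I y → x ≡ y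
  from-injective {x} {y} e = trans (sym (to-from x)) (trans (cong (to I) e) (to-from y))

does-≟-injective : ∀ {a b} (f : Fin a → Fin b) → (∀ {u v} → f u ≡ f v → u ≡ v) →
                   ∀ u v → does (f u ≟ f v) ≡ does (u ≟ v)
does-≟-injective f f-inj u v with u ≟ v | f u ≟ f v
... | yes _  | yes _  = refl
... | no _   | no _   = refl
... | yes eq | no ne  = ⊥-elim (ne (cong f eq))
... | no ne  | yes eq = ⊥-elim (ne (f-inj eq))

xor-cancelʳ : ∀ x y → (x xor y) xor y ≡ x
xor-cancelʳ false false = refl
xor-cancelʳ false true  = refl
xor-cancelʳ true  false = refl
xor-cancelʳ true  true  = refl

xor-absorb : ∀ x y → x xor (y xor x) ≡ y
xor-absorb false y     = xor-identityʳ y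
xor-absorb true  false = refl
xor-absorb true  true  = refl

-- Adding the increment s and then the increment t xor s amounts to adding t.
xor-telescope : ∀ s a t → (s xor a) xor (t xor s) ≡ t xor a
xor-telescope false false false = refl
xor-telescope false false true  = refl
xor-telescope false true  false = refl
xor-telescope false true  true  = refl
xor-telescope true  false false = refl
xor-telescope true  false true  = refl
xor-telescope true  true  false = refl
xor-telescope true  true  true  = refl

infix 7 _·_
_·_ : ∀ {r} → Vec Bool r → Vec Bool r → Bool
[]      · []      = false
(x ∷ b) · (y ∷ c) = (x ∧ y) xor (b · c)

·-comm : ∀ {r} (b c : Vec Bool r) → b · c ≡ c · b
·-comm []      []      = refl
·-comm (x ∷ b) (y ∷ c) = cong₂ _xor_ (∧-comm x y) (·-comm b c)

·-++ : ∀ {r s} (x x' : Vec Bool r) (y y' : Vec Bool s) → (x ++ y) · (x' ++ y') ≡ (x · x') xor (y · y')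
·-++ []      []        y y' = refl
·-++ (a ∷ x) (a' ∷ x') y y' = trans (cong ((a ∧ a') xor_) (·-++ x x' y y')) (sym (xor-assoc (a ∧ a') _ _))

·-zeroˡ : ∀ {r} (y : Vec Bool r) → replicate r false · y ≡ false
·-zeroˡ []      = refl
·-zeroˡ (a ∷ y) = ·-zeroˡ y

·-unit : ∀ {m} (f g : Fin m → Bool) (b : Fin m) →
         tabulate f · tabulate (λ q → does (b ≟ q) ∧ g q) ≡ f b ∧ g b
·-unit {suc m} f g zero = trans (cong ((f zero ∧ g zero) xor_) (vanish (λ q → f (suc q)))) (xor-identityʳ _)
  where
  vanish : ∀ {m} (h : Fin m → Bool) → tabulate h · tabulate {n = m} (λ _ → false) ≡ false
  vanish {zero}  h = refl
  vanish {suc m} h = trans (cong (_xor (tabulate (λ q → h (suc q)) · tabulate (λ _ → false))) (∧-zeroʳ (h zero)))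
                           (vanish (λ q → h (suc q)))
·-unit {suc m} f g (suc b) =
  trans (cong (_xor (tabulate (λ q → f (suc q)) · tabulate (λ q → does (b ≟ q) ∧ g (suc q)))) (∧-zeroʳ (f zero)))
        (·-unit (λ q → f (suc q)) (λ q → g (suc q)) b)

-- The inner product restricted to the positions ≥ ℓ; the head of a vector
-- of length r sits at position r.
levelDot : ∀ {r} → Vec Bool r → Vec Bool r → ℕ → Bool
levelDot             []      []      ℓ = false
levelDot {suc r} (x ∷ b) (y ∷ c) ℓ = (does (ℓ ≤? suc r) ∧ x ∧ y) xor levelDot b c ℓ

levelDot-sym : ∀ {r} (b c : Vec Bool r) ℓ → levelDot b c ℓ ≡ levelDot c b ℓ
levelDot-sym             []      []      ℓ = refl
levelDot-sym {suc r} (x ∷ b) (y ∷ c) ℓ =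
  cong₂ _xor_ (cong (does (ℓ ≤? suc r) ∧_) (∧-comm x y)) (levelDot-sym b c ℓ)

levelDot-vanishes : ∀ {r} (b c : Vec Bool r) {ℓ} → r < ℓ → levelDot b c ℓ ≡ false
levelDot-vanishes             []      []      r<ℓ = refl
levelDot-vanishes {suc r} (x ∷ b) (y ∷ c) {ℓ} r<ℓ
  rewrite dec-false (ℓ ≤? suc r) (<⇒≱ r<ℓ) = levelDot-vanishes b c (≤-trans (n≤1+n _) r<ℓ)

levelDot-head : ∀ {r} (b c : Vec Bool (suc r)) {ℓ} → ℓ ≤ suc r →
                levelDot b c ℓ ≡ (head b ∧ head c) xor levelDot (tail b) (tail c) ℓ
levelDot-head {r} (x ∷ b) (y ∷ c) {ℓ} ℓ≤ rewrite dec-true (ℓ ≤? suc r) ℓ≤ = refl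

levelDot-++ : ∀ {r s} (x x' : Vec Bool r) (z z' : Vec Bool s) {ℓ} → ℓ ≤ suc s →
              levelDot (x ++ z) (x' ++ z') ℓ ≡ (x · x') xor levelDot z z' ℓ
levelDot-++         []      []        z z'     ℓ≤ = refl
levelDot-++ {suc r} {s} (a ∷ x) (a' ∷ x') z z' {ℓ} ℓ≤ = begin
  levelDot ((a ∷ x) ++ z) ((a' ∷ x') ++ z') ℓ
    ≡⟨ levelDot-head (a ∷ x ++ z) (a' ∷ x' ++ z') (≤-trans ℓ≤ (s≤s (m≤n+m s r))) ⟩
  (a ∧ a') xor levelDot (x ++ z) (x' ++ z') ℓ
    ≡⟨ cong ((a ∧ a') xor_) (levelDot-++ x x' z z' ℓ≤) ⟩
  (a ∧ a') xor ((x · x') xor levelDot z z' ℓ)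
    ≡⟨ xor-assoc (a ∧ a') (x · x') (levelDot z z' ℓ) ⟨
  ((a ∷ x) · (a' ∷ x')) xor levelDot z z' ℓ ∎
  where open ≡-Reasoning

halfDist-≤ : ∀ {d} (t : Tree d) x y → halfDist t x y ≤ d
halfDist-≤ leaf x y = z≤n
halfDist-≤ {suc d} (node k f) (i , x) (j , y) with i ≟ j
... | yes refl = ≤-trans (halfDist-≤ (f i) x y) (n≤1+n d)
... | no _     = ≤-refl

halfDist-zero : ∀ {d} (t : Tree d) x y → halfDist t x y ≡ 0 → x ≡ y
halfDist-zero leaf tt tt _ = refl
halfDist-zero (node k f) (i , x) (j , y) with i ≟ j
... | yes refl = λ h≡0 → cong (i ,_) (halfDist-zero (f i) x y h≡0)
... | no _     = λ ()

halfDist-tail : ∀ {d p} (f : Fin (suc (suc p)) → Tree d) i j x y →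
                halfDist (node (suc p) f) (suc i , x) (suc j , y) ≡ halfDist (node p (λ q → f (suc q))) (i , x) (j , y)
halfDist-tail f i j x y with i ≟ j
... | yes refl = refl
... | no _     = refl

-- Every tree has a leaf (so a tree-model needs at least one colour).
someLeaf : ∀ {d} (t : Tree d) → Leaf t
someLeaf leaf       = tt
someLeaf (node p f) = zero , someLeaf (f zero)

onlyChild : ∀ {d} (f : Fin 1 → Tree d) → Leaf (node 0 f) ↔ Leaf (f zero)
onlyChild f = mk↔ₛ′ (λ { (zero , x) → x }) (zero ,_) (λ _ → refl) (λ { (zero , x) → refl })

halfDist-onlyChild : ∀ {d} (f : Fin 1 → Tree d) q q' →
                     halfDist (node 0 f) q q' ≡ halfDist (f zero) (to (onlyChild f) q) (to (onlyChild f) q')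
halfDist-onlyChild f (zero , x) (zero , y) = refl

leafSplit : ∀ {d p} (f : Fin (suc (suc p)) → Tree d) →
            Leaf (node (suc p) f) ↔ (Leaf (f zero) ⊎ Leaf (node p (λ i → f (suc i))))
leafSplit f = mk↔ₛ′ split unsplit
  (λ { (inj₁ x) → refl ; (inj₂ (i , x)) → refl })
  (λ { (zero , x) → refl ; (suc i , x) → refl })
  where
  split : Leaf (node _ f) → Leaf (f zero) ⊎ Leaf (node _ (λ i → f (suc i)))
  split (zero  , x) = inj₁ x
  split (suc i , x) = inj₂ (i , x)
  unsplit : Leaf (f zero) ⊎ Leaf (node _ (λ i → f (suc i))) → Leaf (node _ f)
  unsplit (inj₁ x)       = zero , x
  unsplit (inj₂ (i , x)) = suc i , x

nodeLeaves : ∀ {d p a b} (f : Fin (suc (suc p)) → Tree d) →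
             Leaf (f zero) ↔ Fin a → Leaf (node p (λ i → f (suc i))) ↔ Fin b → Leaf (node (suc p) f) ↔ Fin (a + b)
nodeLeaves f L₀ L₁ = ↔-trans (leafSplit f) (↔-trans (L₀ ⊎-↔ L₁) (↔-sym +↔⊎))

mutual
  leafCount : ∀ {d} → Tree d → ℕ
  leafCount leaf       = 1
  leafCount (node p f) = childLeafCount p f

  childLeafCount : ∀ {d} p → (Fin (suc p) → Tree d) → ℕ
  childLeafCount zero    f = leafCount (f zero)
  childLeafCount (suc p) f = leafCount (f zero) + childLeafCount p (λ i → f (suc i))

mutual
  enumerateLeaves : ∀ {d} (t : Tree d) → Leaf t ↔ Fin (leafCount t)
  enumerateLeaves leaf       = mk↔ₛ′ (λ _ → zero) (λ _ → tt) (λ { zero → refl }) (λ _ → refl)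
  enumerateLeaves (node p f) = enumerateChildren p f

  enumerateChildren : ∀ {d} p (f : Fin (suc p) → Tree d) → Leaf (node p f) ↔ Fin (childLeafCount p f)
  enumerateChildren zero    f = ↔-trans (onlyChild f) (enumerateLeaves (f zero))
  enumerateChildren (suc p) f = nodeLeaves f (enumerateLeaves (f zero)) (enumerateChildren p (λ i → f (suc i)))

-- A tree of depth 0 is a single leaf.
singleLeaf : ∀ {N} → ⊤ ↔ Fin N → N ≡ 1
singleLeaf {zero}        L = ⊥-elim (¬Fin0 (to L tt))
singleLeaf {suc zero}    L = refl
singleLeaf {suc (suc N)} L with from-injective L {zero} {suc zero} refl
... | ()

-- The subgraph induced along a map into V(H) (injective in all uses).
induced : (H : Graph) {a : ℕ} → (Fin a → Fin (n H)) → Graph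
induced H {a} e = record
  { n = a ; adj = λ x y → adj H (e x) (e y)
  ; adj-sym = λ x y → adj-sym H (e x) (e y) ; adj-irrefl = λ x → adj-irrefl H (e x) }

iso-refl : ∀ G → Iso G G
iso-refl G = record { bij = ↔-refl ; preserve = λ _ _ → refl }

iso-trans : ∀ {A B C} → Iso A B → Iso B C → Iso A C
iso-trans φ ψ = record
  { bij = ↔-trans (Iso.bij φ) (Iso.bij ψ)
  ; preserve = λ u v → trans (Iso.preserve ψ _ _) (Iso.preserve φ u v) }

⊕-congʳ : ∀ A {X Y} → Iso X Y → Iso (A ⊕ X) (A ⊕ Y)
⊕-congʳ A {X} {Y} φ = record
  { bij = ↔-trans +↔⊎ (↔-trans (↔-refl ⊎-↔ Iso.bij φ) (↔-sym +↔⊎))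
  ; preserve = λ u v → trans (cong₂ (⊕adj (adj A) (adj Y)) (rejoin u) (rejoin v)) (mapped (splitAt (n A) u) (splitAt (n A) v)) }
  where
  rejoin : ∀ u → splitAt (n A) (join (n A) (n Y) (Sum.map₂ (to (Iso.bij φ)) (splitAt (n A) u)))
                 ≡ Sum.map₂ (to (Iso.bij φ)) (splitAt (n A) u)
  rejoin u = splitAt-join (n A) (n Y) (Sum.map₂ (to (Iso.bij φ)) (splitAt (n A) u))
  mapped : ∀ s s' → ⊕adj (adj A) (adj Y) (Sum.map₂ (to (Iso.bij φ)) s) (Sum.map₂ (to (Iso.bij φ)) s')
                  ≡ ⊕adj (adj A) (adj X) s s'
  mapped (inj₁ x) (inj₁ y) = refl
  mapped (inj₂ x) (inj₂ y) = Iso.preserve φ x y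
  mapped (inj₁ x) (inj₂ y) = refl
  mapped (inj₂ x) (inj₁ y) = refl

splitIso : ∀ (H : Graph) {a b} (e : (Fin a ⊎ Fin b) ↔ Fin (n H)) →
           (∀ x y → adj H (to e (inj₁ x)) (to e (inj₂ y)) ≡ false) →
           Iso (induced H (λ x → to e (inj₁ x)) ⊕ induced H (λ y → to e (inj₂ y))) H
splitIso H {a} e noEdge = record
  { bij = ↔-trans +↔⊎ e
  ; preserve = λ u v → parts (splitAt a u) (splitAt a v) }
  where
  parts : ∀ s s' → adj H (to e s) (to e s')
                 ≡ ⊕adj (λ x y → adj H (to e (inj₁ x)) (to e (inj₁ y)))
                        (λ x y → adj H (to e (inj₂ x)) (to e (inj₂ y))) s s'
  parts (inj₁ x) (inj₁ y) = refl
  parts (inj₂ x) (inj₂ y) = refl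
  parts (inj₁ x) (inj₂ y) = noEdge x y
  parts (inj₂ x) (inj₁ y) = trans (adj-sym H _ _) (noEdge y x)

complementOn-adj : ∀ G X {u v} → u ≢ v → adj (complementOn G X) u v ≡ adj G u v xor (X u ∧ X v)
complementOn-adj G X {u} {v} u≢v rewrite dec-false (u ≟ v) u≢v | ∧-identityʳ (X v) = refl

complement-involutive : ∀ G X → Iso (complementOn (complementOn G X) X) G
complement-involutive G X = record
  { bij = ↔-refl ; preserve = λ u v → sym (xor-cancelʳ (adj G u v) _) }

complement-empty : ∀ G → Iso (complementOn G (λ _ → false)) G
complement-empty G = record { bij = ↔-refl ; preserve = λ u v → sym (xor-identityʳ (adj G u v)) }

complement-transport : ∀ {A B} (φ : Iso A B) (X : Fin (n B) → Bool) →
                       Iso (complementOn A (λ u → X (to (Iso.bij φ) u))) (complementOn B X)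
complement-transport φ X = record
  { bij = Iso.bij φ
  ; preserve = λ u v → cong₂ _xor_ (Iso.preserve φ u v)
      (cong (λ b → X (to (Iso.bij φ) u) ∧ X (to (Iso.bij φ) v) ∧ not b)
            (does-≟-injective (to (Iso.bij φ)) (to-injective (Iso.bij φ)) u v)) }

record BitModel {d} (t : Tree d) (r : ℕ) (G : Graph) : Set where
  field
    leaves  : Leaf t ↔ Fin (n G)
    bits    : Fin (n G) → Vec Bool r
    correct : ∀ u v → u ≢ v →
              adj G u v ≡ levelDot (bits u) (bits v) (halfDist t (from leaves u) (from leaves v))

  correctAt : ∀ x y → x ≢ y →
              adj G (to leaves x) (to leaves y) ≡ levelDot (bits (to leaves x)) (bits (to leaves y)) (halfDist t x y)
  correctAt x y x≢y =
    trans (correct _ _ (λ eq → x≢y (to-injective leaves eq)))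
          (cong₂ (λ x' y' → levelDot (bits (to leaves x)) (bits (to leaves y)) (halfDist t x' y'))
                 (from-to leaves x) (from-to leaves y))

open BitModel

BitModelled : ℕ → ℕ → Graph → Set
BitModelled d r G = Σ (Tree d) λ t → BitModel t r G

transport : ∀ {d r G H} {t : Tree d} → BitModel t r G → Iso G H → BitModel t r H
transport {G = G} {H} M φ = record
  { leaves  = ↔-trans (leaves M) B
  ; bits    = λ w → bits M (from B w)
  ; correct = λ w w' w≢w' → trans (cong₂ (adj H) (sym (to-from B w)) (sym (to-from B w')))
                                  (trans (Iso.preserve φ _ _) (correct M _ _ (λ eq → w≢w' (from-injective B eq)))) }
  where
  B : Fin (n G) ↔ Fin (n H)
  B = Iso.bij φ

singletonModel : ∀ G → n G ≡ 1 → BitModel leaf 0 G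
singletonModel G refl = record
  { leaves = mk↔ₛ′ (λ _ → zero) (λ _ → tt) (λ { zero → refl }) (λ _ → refl)
  ; bits = λ _ → [] ; correct = λ { zero zero 0≢0 → ⊥-elim (0≢0 refl) } }

underRoot : ∀ {d r G} {t : Tree d} → BitModel t r G → BitModel (node 0 (λ _ → t)) r G
underRoot M = record
  { leaves = ↔-trans (onlyChild _) (leaves M) ; bits = bits M ; correct = correct M }

_◂_ : ∀ {d p} → Tree d → (Fin (suc p) → Tree d) → Fin (suc (suc p)) → Tree d
(t₀ ◂ f) zero    = t₀
(t₀ ◂ f) (suc i) = f i

graft : ∀ {d} → Tree d → Tree (suc d) → Tree (suc d)
graft t₀ (node p f) = node (suc p) (t₀ ◂ f)

-- Grafting the tree of a model of G₀ onto the root of a model of R models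
-- G₀ ⊕ R: leaves in different parts are at distance 2(d+1), where all r ≤ d
-- bits are inactive.
beside : ∀ {d r G₀ R} {t₀ : Tree d} → r ≤ d → BitModel t₀ r G₀ →
         (t : Tree (suc d)) → BitModel t r R → BitModel (graft t₀ t) r (G₀ ⊕ R)
beside {d} {r} {G₀} {R} {t₀} r≤d M₀ (node p f) M = record
  { leaves  = nodeLeaves (t₀ ◂ f) (leaves M₀) (leaves M)
  ; bits    = λ u → partBits (splitAt (n G₀) u)
  ; correct = λ u v u≢v → parts (splitAt (n G₀) u) (splitAt (n G₀) v) (λ eq → u≢v (to-injective +↔⊎ eq)) }
  where
  partBits : Fin (n G₀) ⊎ Fin (n R) → Vec Bool r
  partBits = [ bits M₀ , bits M ]′
  leafOf : Fin (n G₀) ⊎ Fin (n R) → Leaf (graft t₀ (node p f))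
  leafOf s = from (leafSplit (t₀ ◂ f)) (Sum.map (from (leaves M₀)) (from (leaves M)) s)
  parts : ∀ s s' → s ≢ s' →
          ⊕adj (adj G₀) (adj R) s s' ≡ levelDot (partBits s) (partBits s') (halfDist (graft t₀ (node p f)) (leafOf s) (leafOf s'))
  parts (inj₁ x) (inj₁ y) x≢y = correct M₀ x y (λ eq → x≢y (cong inj₁ eq))
  parts (inj₂ x) (inj₂ y) x≢y = trans (correct M x y (λ eq → x≢y (cong inj₂ eq)))
    (cong (levelDot (bits M x) (bits M y))
          (sym (halfDist-tail (t₀ ◂ f) _ _ (proj₂ (from (leaves M) x)) (proj₂ (from (leaves M) y)))))
  parts (inj₁ x) (inj₂ y) _ = sym (levelDot-vanishes (bits M₀ x) (bits M y) (s≤s r≤d))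
  parts (inj₂ x) (inj₁ y) _ = sym (levelDot-vanishes (bits M x) (bits M₀ y) (s≤s r≤d))

union : ∀ {d r G₀ Gs} → r ≤ d → BitModelled d r G₀ → All (BitModelled d r) Gs → BitModelled (suc d) r (⨁ G₀ Gs)
union r≤d (t , M) []        = node 0 (λ _ → t) , underRoot M
union r≤d (t , M) (N ∷ Ns)  with union r≤d N Ns
... | (t' , M') = graft t t' , beside r≤d M t' M'

-- Complementing inside X adds the bit X as a new top position, active at
-- every distance since d ≤ r + 1.
complement : ∀ {d r H} {t : Tree d} → d ≤ suc r → BitModel t r H → (X : Fin (n H) → Bool) →
             BitModel t (suc r) (complementOn H X)
complement {H = H} {t} d≤ M X = record
  { leaves = leaves M ; bits = λ u → X u ∷ bits M u ; correct = flipped }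
  where
  flipped : ∀ u v → u ≢ v → adj (complementOn H X) u v
            ≡ levelDot (X u ∷ bits M u) (X v ∷ bits M v) (halfDist t (from (leaves M) u) (from (leaves M) v))
  flipped u v u≢v = begin
    adj (complementOn H X) u v                      ≡⟨ complementOn-adj H X u≢v ⟩
    adj H u v xor (X u ∧ X v)                       ≡⟨ cong (_xor (X u ∧ X v)) (correct M u v u≢v) ⟩
    levelDot (bits M u) (bits M v) ℓ xor (X u ∧ X v) ≡⟨ xor-comm _ (X u ∧ X v) ⟩
    (X u ∧ X v) xor levelDot (bits M u) (bits M v) ℓ
      ≡⟨ levelDot-head (X u ∷ bits M u) (X v ∷ bits M v) (≤-trans (halfDist-≤ t _ _) d≤) ⟨
    levelDot (X u ∷ bits M u) (X v ∷ bits M v) ℓ    ∎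
    where
    open ≡-Reasoning
    ℓ : ℕ
    ℓ = halfDist t (from (leaves M) u) (from (leaves M) v)

mutual
  sc→model : ∀ {k G} → SC k G → BitModelled k k G
  sc→model (sc-base G one) = leaf , singletonModel G one
  sc→model (sc-step G G₀ Gs s ss X φ) with union ≤-refl (sc→model s) (sc→models ss)
  ... | (t , M) = t , transport (complement ≤-refl M X) φ

  sc→models : ∀ {k Gs} → All (SC k) Gs → All (BitModelled k k) Gs
  sc→models []       = []
  sc→models (s ∷ ss) = sc→model s ∷ sc→models ss

bitVectors : ∀ k → Fin (2 ^ k) ↔ Vec Bool k
bitVectors zero    = mk↔ₛ′ (λ _ → []) (λ _ → zero) (λ { [] → refl }) (λ { zero → refl })
bitVectors (suc k) = ↔-trans *↔× (↔-trans (2↔Bool ×-↔ bitVectors k) cons)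
  where
  cons : (Bool × Vec Bool k) ↔ Vec Bool (suc k)
  cons = mk↔ₛ′ (λ (x , v) → x ∷ v) (λ v → head v , tail v) (λ { (x ∷ v) → refl }) (λ _ → refl)

model→TM : ∀ {d k G} {t : Tree d} → BitModel t k G → TM d (2 ^ k) G
model→TM {d} {k} {G} {t} M = record
  { T       = t
  ; leaves  = leaves M
  ; colour  = λ u → from (bitVectors k) (bits M u)
  ; S       = λ i j ℓ → levelDot (to (bitVectors k) i) (to (bitVectors k) j) ℓ
  ; S-sym   = λ i j ℓ → levelDot-sym (to (bitVectors k) i) (to (bitVectors k) j) ℓ
  ; correct = λ u v u≢v → trans (correct M u v u≢v)
      (sym (cong₂ (λ b c → levelDot b c _) (to-from (bitVectors k) (bits M u)) (to-from (bitVectors k) (bits M v)))) }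

uncomplement : ∀ {d r G} {t : Tree d} → d ≤ suc r → (M : BitModel t (suc r) G) →
               BitModel t r (complementOn G (λ u → head (bits M u)))
uncomplement {G = G} {t} d≤ M = record
  { leaves = leaves M ; bits = λ u → tail (bits M u) ; correct = unflipped }
  where
  X : Fin (n G) → Bool
  X u = head (bits M u)
  unflipped : ∀ u v → u ≢ v → adj (complementOn G X) u v
              ≡ levelDot (tail (bits M u)) (tail (bits M v)) (halfDist t (from (leaves M) u) (from (leaves M) v))
  unflipped u v u≢v = begin
    adj (complementOn G X) u v                            ≡⟨ complementOn-adj G X u≢v ⟩
    adj G u v xor (X u ∧ X v)                             ≡⟨ cong (_xor (X u ∧ X v)) (correct M u v u≢v) ⟩
    levelDot (bits M u) (bits M v) ℓ xor (X u ∧ X v)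
      ≡⟨ cong (_xor (X u ∧ X v)) (levelDot-head (bits M u) (bits M v) (≤-trans (halfDist-≤ t _ _) d≤)) ⟩
    ((X u ∧ X v) xor levelDot (tail (bits M u)) (tail (bits M v)) ℓ) xor (X u ∧ X v)
      ≡⟨ cong (_xor (X u ∧ X v)) (xor-comm (X u ∧ X v) _) ⟩
    (levelDot (tail (bits M u)) (tail (bits M v)) ℓ xor (X u ∧ X v)) xor (X u ∧ X v)
      ≡⟨ xor-cancelʳ _ (X u ∧ X v) ⟩
    levelDot (tail (bits M u)) (tail (bits M v)) ℓ        ∎
    where
    open ≡-Reasoning
    ℓ : ℕ
    ℓ = halfDist t (from (leaves M) u) (from (leaves M) v)

restrict : ∀ {d d' r H a} {t : Tree d} {t' : Tree d'} (M : BitModel t r H) (L' : Leaf t' ↔ Fin a)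
           (ι : Leaf t' → Leaf t) → (∀ {x y} → ι x ≡ ι y → x ≡ y) →
           (∀ x y → halfDist t (ι x) (ι y) ≡ halfDist t' x y) →
           BitModel t' r (induced H (λ x → to (leaves M) (ι (from L' x))))
restrict {r = r} {a = a} M L' ι ι-injective ι-isometric = record
  { leaves  = L'
  ; bits    = bitsAt
  ; correct = λ x y x≢y → trans (correctAt M _ _ (λ eq → x≢y (from-injective L' (ι-injective eq))))
                                (cong (levelDot (bitsAt x) (bitsAt y)) (ι-isometric (from L' x) (from L' y))) }
  where
  bitsAt : Fin a → Vec Bool r
  bitsAt x = bits M (to (leaves M) (ι (from L' x)))

dropRoot : ∀ {d r H} {f : Fin 1 → Tree d} → BitModel (node 0 f) r H → BitModel (f zero) r H
dropRoot {f = f} M = record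
  { leaves  = ↔-trans (↔-sym (onlyChild f)) (leaves M)
  ; bits    = bits M
  ; correct = λ u v u≢v → trans (correct M u v u≢v)
                                (cong (levelDot (bits M u) (bits M v)) (halfDist-onlyChild f (from (leaves M) u) (from (leaves M) v))) }

record Components (d r : ℕ) (H : Graph) : Set where
  field
    first       : Graph
    rest        : List Graph
    firstModel  : BitModelled d r first
    restModels  : All (BitModelled d r) rest
    iso         : Iso (⨁ first rest) H

open Components

-- The subtrees at the root of a model with r ≤ d bits are the components of
-- a disjoint union: leaves below different children are at distance 2(d+1),
-- where no bit is active.
components : ∀ {d r H} p (f : Fin (suc p) → Tree d) → r ≤ d → BitModel (node p f) r H → Components d r H
components {H = H} zero f r≤d M = record
  { first = H ; rest = [] ; firstModel = f zero , dropRoot M ; restModels = [] ; iso = iso-refl H }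
components {d} {r} {H} (suc p) f r≤d M = record
  { first      = H₁
  ; rest       = first C ∷ rest C
  ; firstModel = f zero , M₁
  ; restModels = firstModel C ∷ restModels C
  ; iso        = iso-trans (⊕-congʳ H₁ (iso C)) (splitIso H e noEdge) }
  where
  g : Fin (suc p) → Tree d
  g i = f (suc i)
  L₁ : Leaf (f zero) ↔ Fin (leafCount (f zero))
  L₁ = enumerateLeaves (f zero)
  L₂ : Leaf (node p g) ↔ Fin (childLeafCount p g)
  L₂ = enumerateChildren p g
  e : (Fin (leafCount (f zero)) ⊎ Fin (childLeafCount p g)) ↔ Fin (n H)
  e = ↔-trans (↔-sym (L₁ ⊎-↔ L₂)) (↔-trans (↔-sym (leafSplit f)) (leaves M))
  H₁ : Graph
  H₁ = induced H (λ x → to e (inj₁ x))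
  underSuc : Leaf (node p g) → Leaf (node (suc p) f)
  underSuc (i , x) = suc i , x
  M₁ : BitModel (f zero) r H₁
  M₁ = restrict M L₁ (zero ,_) (λ { refl → refl }) (λ _ _ → refl)
  M₂ : BitModel (node p g) r (induced H (λ y → to e (inj₂ y)))
  M₂ = restrict M L₂ underSuc (λ { refl → refl }) (λ { (i , x) (j , y) → halfDist-tail f i j x y })
  C : Components d r (induced H (λ y → to e (inj₂ y)))
  C = components p g r≤d M₂
  noEdge : ∀ x y → adj H (to e (inj₁ x)) (to e (inj₂ y)) ≡ false
  noEdge x y = trans (correctAt M _ _ (λ ())) (levelDot-vanishes (bits M (to e (inj₁ x))) (bits M (to e (inj₂ y))) (s≤s r≤d))

-- Bit-models ⊆ SC_k: the top bit is the set X to complement, and the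
-- subtrees at the root give the components of the disjoint union.
mutual
  model→SC : ∀ {k G} → BitModelled k k G → SC k G
  model→SC {zero}  {G} (leaf , M)       = sc-base G (singleLeaf (leaves M))
  model→SC {suc k} {G} (node p f , M) =
    sc-step G (first C) (rest C) (model→SC (firstModel C)) (models→SC (restModels C))
            (λ u → X (to (Iso.bij (iso C)) u))
            (iso-trans (complement-transport (iso C) X) (complement-involutive G X))
    where
    X : Fin (n G) → Bool
    X u = head (bits M u)
    C : Components k k (complementOn G X)
    C = components p f ≤-refl (uncomplement ≤-refl M)

  models→SC : ∀ {k Gs} → All (BitModelled k k) Gs → All (SC k) Gs
  models→SC []       = []
  models→SC (M ∷ Ms) = model→SC M ∷ models→SC Ms

-- Every symmetric Boolean matrix is the Gram matrix over GF(2) of vectors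
-- of length gramDim m = m(m+1)/2 (gram-correct), by eliminating row 0.
IsSymmetric : ∀ {m} → (Fin m → Fin m → Bool) → Set
IsSymmetric M = ∀ a b → M a b ≡ M b a

gramDim : ℕ → ℕ
gramDim zero    = 0
gramDim (suc m) = m + suc (gramDim m)

firstRow : ∀ {m} → (Fin (suc m) → Fin (suc m) → Bool) → Vec Bool m
firstRow M = tabulate (λ q → M zero (suc q))

scaledUnit : ∀ {m} → (Fin (suc m) → Fin (suc m) → Bool) → Fin m → Vec Bool m
scaledUnit M a = tabulate (λ q → does (a ≟ q) ∧ M zero (suc q))

-- The entry that corrects the square of firstRow M to the diagonal entry M 0 0.
diagonalFix : ∀ {m} → (Fin (suc m) → Fin (suc m) → Bool) → Bool
diagonalFix M = M zero zero xor (firstRow M · firstRow M)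

-- What remains of M on the indices 1…m once the scaled unit vectors are
-- paired with each other.
residual : ∀ {m} → (Fin (suc m) → Fin (suc m) → Bool) → Fin m → Fin m → Bool
residual M a b = M (suc a) (suc b) xor (does (a ≟ b) ∧ M zero (suc b))

residual-symmetric : ∀ {m} (M : Fin (suc m) → Fin (suc m) → Bool) → IsSymmetric M → IsSymmetric (residual M)
residual-symmetric M M-sym a b with a ≟ b | b ≟ a
... | yes refl | yes _   = refl
... | yes refl | no a≢a  = ⊥-elim (a≢a refl)
... | no a≢b   | yes b≡a = ⊥-elim (a≢b (sym b≡a))
... | no _     | no _    = cong (_xor false) (M-sym (suc a) (suc b))

gramVectors : ∀ m → (Fin m → Fin m → Bool) → Fin m → Vec Bool (gramDim m)
gramVectors (suc m) M zero    = firstRow M ++ (diagonalFix M ∷ replicate (gramDim m) false)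
gramVectors (suc m) M (suc a) = scaledUnit M a ++ (false ∷ gramVectors m (residual M) a)

gram-correct : ∀ m (M : Fin m → Fin m → Bool) → IsSymmetric M →
               ∀ a b → gramVectors m M a · gramVectors m M b ≡ M a b
gram-correct (suc m) M M-sym zero zero = begin
  (P ++ (c ∷ zeros)) · (P ++ (c ∷ zeros))   ≡⟨ ·-++ P P (c ∷ zeros) (c ∷ zeros) ⟩
  (P · P) xor ((c ∧ c) xor (zeros · zeros)) ≡⟨ cong₂ (λ x y → (P · P) xor (x xor y)) (∧-idem c) (·-zeroˡ zeros) ⟩
  (P · P) xor (c xor false)                 ≡⟨ cong ((P · P) xor_) (xor-identityʳ c) ⟩
  (P · P) xor (M zero zero xor (P · P))     ≡⟨ xor-absorb (P · P) (M zero zero) ⟩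
  M zero zero                               ∎
  where
  open ≡-Reasoning
  P : Vec Bool m
  P = firstRow M
  c : Bool
  c = diagonalFix M
  zeros : Vec Bool (gramDim m)
  zeros = replicate (gramDim m) false
gram-correct (suc m) M M-sym zero (suc b) = begin
  (firstRow M ++ (diagonalFix M ∷ replicate (gramDim m) false)) · (scaledUnit M b ++ (false ∷ gramVectors m (residual M) b))
    ≡⟨ ·-++ (firstRow M) (scaledUnit M b) (diagonalFix M ∷ replicate (gramDim m) false) (false ∷ gramVectors m (residual M) b) ⟩
  (firstRow M · scaledUnit M b) xor ((diagonalFix M ∧ false) xor (replicate (gramDim m) false · gramVectors m (residual M) b))
    ≡⟨ cong₂ (λ x y → (firstRow M · scaledUnit M b) xor (x xor y))
             (∧-zeroʳ (diagonalFix M)) (·-zeroˡ (gramVectors m (residual M) b)) ⟩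
  (firstRow M · scaledUnit M b) xor false ≡⟨ xor-identityʳ (firstRow M · scaledUnit M b) ⟩
  firstRow M · scaledUnit M b             ≡⟨ ·-unit (λ q → M zero (suc q)) (λ q → M zero (suc q)) b ⟩
  M zero (suc b) ∧ M zero (suc b)         ≡⟨ ∧-idem (M zero (suc b)) ⟩
  M zero (suc b)                          ∎
  where open ≡-Reasoning
gram-correct (suc m) M M-sym (suc a) zero =
  trans (·-comm (gramVectors (suc m) M (suc a)) (gramVectors (suc m) M zero))
        (trans (gram-correct (suc m) M M-sym zero (suc a)) (M-sym zero (suc a)))
gram-correct (suc m) M M-sym (suc a) (suc b) = begin
  (scaledUnit M a ++ (false ∷ R a)) · (scaledUnit M b ++ (false ∷ R b))
    ≡⟨ ·-++ (scaledUnit M a) (scaledUnit M b) (false ∷ R a) (false ∷ R b) ⟩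
  (scaledUnit M a · scaledUnit M b) xor (false xor (R a · R b))
    ≡⟨ cong₂ _xor_ (·-unit (λ q → does (a ≟ q) ∧ M zero (suc q)) (λ q → M zero (suc q)) b)
                   (gram-correct m (residual M) (residual-symmetric M M-sym) a b) ⟩
  (x ∧ M zero (suc b)) xor residual M a b
    ≡⟨ cong (_xor residual M a b) (trans (∧-assoc (does (a ≟ b)) _ _) (cong (does (a ≟ b) ∧_) (∧-idem _))) ⟩
  x xor (M (suc a) (suc b) xor x)         ≡⟨ xor-absorb x (M (suc a) (suc b)) ⟩
  M (suc a) (suc b)                       ∎
  where
  open ≡-Reasoning
  R : Fin m → Vec Bool (gramDim m)
  R = gramVectors m (residual M)
  -- the common overlap of the scaled unit vectors of a and b
  x : Bool
  x = does (a ≟ b) ∧ M zero (suc b)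

chain : ∀ c {d} → Tree d → Tree (c + d)
chain zero    t = t
chain (suc c) t = node 0 (λ _ → chain c t)

chainLeaves : ∀ c {d} (t : Tree d) → Leaf t ↔ Leaf (chain c t)
chainLeaves zero    t = ↔-refl
chainLeaves (suc c) t = ↔-trans (chainLeaves c t) (↔-sym (onlyChild (λ _ → chain c t)))

halfDist-chain : ∀ c {d} (t : Tree d) x y →
                 halfDist (chain c t) (to (chainLeaves c t) x) (to (chainLeaves c t) y) ≡ halfDist t x y
halfDist-chain zero    t x y = refl
halfDist-chain (suc c) t x y = halfDist-chain c t x y

childwise : ∀ {d e p} {f : Fin (suc p) → Tree d} {g : Fin (suc p) → Tree e} →
            (∀ i → Leaf (f i) ↔ Leaf (g i)) → Leaf (node p f) ↔ Leaf (node p g)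
childwise L = mk↔ₛ′ (λ (i , x) → i , to (L i) x) (λ (i , y) → i , from (L i) y)
  (λ (i , y) → cong (i ,_) (to-from (L i) y)) (λ (i , x) → cong (i ,_) (from-to (L i) x))

module Stretch (c : ℕ) where

  stretch : ℕ → ℕ
  stretch zero    = 0
  stretch (suc d) = c + suc (stretch d)

  -- The new half-distance of two leaves at half-distance h.
  stretchDist : ℕ → ℕ
  stretchDist zero    = 0
  stretchDist (suc h) = suc (stretch h)

  expand : ∀ {d} → Tree d → Tree (stretch d)
  expand leaf       = leaf
  expand (node p f) = chain c (node p (λ i → expand (f i)))

  expandLeaves : ∀ {d} (t : Tree d) → Leaf t ↔ Leaf (expand t)
  expandLeaves leaf       = ↔-refl
  expandLeaves (node p f) = ↔-trans (childwise (λ i → expandLeaves (f i))) (chainLeaves c _)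

  halfDist-expand : ∀ {d} (t : Tree d) x y →
                    halfDist (expand t) (to (expandLeaves t) x) (to (expandLeaves t) y) ≡ stretchDist (halfDist t x y)
  halfDist-expand leaf       tt      tt      = refl
  halfDist-expand (node p f) (i , x) (j , y) =
    trans (halfDist-chain c (node p (λ k → expand (f k))) (i , to (expandLeaves (f i)) x) (j , to (expandLeaves (f j)) y))
          (atRoot i j x y)
    where
    atRoot : ∀ i j x y → halfDist (node p (λ k → expand (f k))) (i , to (expandLeaves (f i)) x) (j , to (expandLeaves (f j)) y)
                         ≡ stretchDist (halfDist (node p f) (i , x) (j , y))
    atRoot i j x y with i ≟ j
    ... | yes refl = halfDist-expand (f i) x y
    ... | no _     = refl

  stretch-mono : ∀ {ℓ d} → ℓ ≤ d → stretch ℓ ≤ stretch d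
  stretch-mono z≤n       = z≤n
  stretch-mono (s≤s ℓ≤d) = +-monoʳ-≤ c (s≤s (stretch-mono ℓ≤d))

  stretch-bound : ∀ K → suc c ≤ K → ∀ d → stretch d ≤ d * K
  stretch-bound K c<K zero    = z≤n
  stretch-bound K c<K (suc d) rewrite +-suc c (stretch d) = +-mono-≤ c<K (stretch-bound K c<K d)

-- A level-indexed family S of symmetric m × m matrices is realised by bit
-- vectors on the tree stretched by gramDim m: the block of level h holds
-- Gram vectors of S_h xor S_{h+1}, so the positions from level h upwards
-- telescope to S_h.
module LevelBits {m} (S : Fin m → Fin m → ℕ → Bool) (S-sym : ∀ i j ℓ → S i j ℓ ≡ S j i ℓ) where
  open Stretch (gramDim m)

  -- levelBits e above: the blocks of levels e, …, 1, where `above` is the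
  -- contribution of the levels above e.
  levelBits : ∀ e → (Fin m → Fin m → Bool) → Fin m → Vec Bool (stretch e)
  levelBits zero    above a = []
  levelBits (suc e) above a =
    gramVectors m (λ x y → S x y (suc e) xor above x y) a ++ (false ∷ levelBits e (λ x y → S x y (suc e)) a)

  levelBits-correct : ∀ e above → IsSymmetric above → ∀ a b {ℓ} → ℓ < e →
                      levelDot (levelBits e above a) (levelBits e above b) (suc (stretch ℓ)) ≡ S a b (suc ℓ) xor above a b
  levelBits-correct (suc e) above above-sym a b {ℓ} (s≤s ℓ≤e) = begin
    levelDot (block a ++ (false ∷ lower a)) (block b ++ (false ∷ lower b)) (suc (stretch ℓ))
      ≡⟨ levelDot-++ (block a) (block b) (false ∷ lower a) (false ∷ lower b)
                     (s≤s (≤-trans (stretch-mono ℓ≤e) (n≤1+n _))) ⟩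
    (block a · block b) xor levelDot (false ∷ lower a) (false ∷ lower b) (suc (stretch ℓ))
      ≡⟨ cong₂ _xor_ (gram-correct m difference difference-sym a b)
                     (levelDot-head (false ∷ lower a) (false ∷ lower b) (s≤s (stretch-mono ℓ≤e))) ⟩
    (S a b (suc e) xor above a b) xor (false xor levelDot (lower a) (lower b) (suc (stretch ℓ)))
      ≡⟨ lowerLevels (m≤n⇒m<n∨m≡n ℓ≤e) ⟩
    S a b (suc ℓ) xor above a b ∎
    where
    open ≡-Reasoning
    difference : Fin m → Fin m → Bool
    difference x y = S x y (suc e) xor above x y
    difference-sym : IsSymmetric difference
    difference-sym x y = cong₂ _xor_ (S-sym x y (suc e)) (above-sym x y)
    block : Fin m → Vec Bool (gramDim m)
    block = gramVectors m difference
    lower : Fin m → Vec Bool (stretch e)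
    lower = levelBits e (λ x y → S x y (suc e))
    -- Either ℓ = e and the lower blocks are inactive, or they telescope.
    lowerLevels : ℓ < e ⊎ ℓ ≡ e →
                  (S a b (suc e) xor above a b) xor levelDot (lower a) (lower b) (suc (stretch ℓ)) ≡ S a b (suc ℓ) xor above a b
    lowerLevels (inj₂ refl) =
      trans (cong (difference a b xor_) (levelDot-vanishes (lower a) (lower b) ≤-refl)) (xor-identityʳ (difference a b))
    lowerLevels (inj₁ ℓ<e) =
      trans (cong (difference a b xor_) (levelBits-correct e (λ x y → S x y (suc e)) (λ x y → S-sym x y (suc e)) a b ℓ<e))
            (xor-telescope (S a b (suc e)) (above a b) (S a b (suc ℓ)))

  colourBits : ∀ d → Fin m → Vec Bool (stretch d)
  colourBits d = levelBits d (λ _ _ → false)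

  colourBits-correct : ∀ d a b h → h ≤ d → h ≢ 0 → S a b h ≡ levelDot (colourBits d a) (colourBits d b) (stretchDist h)
  colourBits-correct d a b zero    _   h≢0 = ⊥-elim (h≢0 refl)
  colourBits-correct d a b (suc ℓ) h≤d _   =
    sym (trans (levelBits-correct d (λ _ _ → false) (λ _ _ → refl) a b h≤d) (xor-identityʳ (S a b (suc ℓ))))

tm→model : ∀ {d m G} (M : TM d m G) → BitModel (Stretch.expand (gramDim m) (TM.T M)) (Stretch.stretch (gramDim m) d) G
tm→model {d} {m} {G} M = record
  { leaves  = ↔-trans (↔-sym (expandLeaves T)) L
  ; bits    = λ u → colourBits d (colour u)
  ; correct = λ u v u≢v → begin
      adj G u v
        ≡⟨ adjacency u v u≢v ⟩
      S (colour u) (colour v) (halfDist T (from L u) (from L v))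
        ≡⟨ colourBits-correct d (colour u) (colour v) _ (halfDist-≤ T _ _)
                              (λ h≡0 → u≢v (from-injective L (halfDist-zero T _ _ h≡0))) ⟩
      levelDot (colourBits d (colour u)) (colourBits d (colour v)) (stretchDist (halfDist T (from L u) (from L v)))
        ≡⟨ cong (levelDot (colourBits d (colour u)) (colourBits d (colour v))) (halfDist-expand T (from L u) (from L v)) ⟨
      levelDot (colourBits d (colour u)) (colourBits d (colour v))
               (halfDist (expand T) (to (expandLeaves T) (from L u)) (to (expandLeaves T) (from L v))) ∎ }
  where
  open TM M using (T; colour; S; S-sym) renaming (leaves to L; correct to adjacency)
  open Stretch (gramDim m)
  open LevelBits S S-sym
  open ≡-Reasoning

gramDim-≤ : ∀ m → gramDim m ≤ m * m
gramDim-≤ zero    = z≤n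
gramDim-≤ (suc m) rewrite +-suc m (gramDim m) | *-suc m m =
  s≤s (+-monoʳ-≤ m (≤-trans (gramDim-≤ m) (m≤n+m (m * m) m)))

stretchFactor-≤ : ∀ m → suc (gramDim (suc m)) ≤ suc m * (suc m + 1)
stretchFactor-≤ m = begin
  suc (gramDim K) ≤⟨ s≤s (gramDim-≤ K) ⟩
  suc (K * K)     ≤⟨ +-monoˡ-≤ (K * K) (s≤s z≤n) ⟩
  K + K * K       ≡⟨ *-suc K K ⟨
  K * suc K       ≡⟨ cong (K *_) (+-comm 1 K) ⟩
  K * (K + 1)     ∎
  where
  open ≤-Reasoning
  K : ℕ
  K = suc m

-- SC_k ⊆ SC_{k+1}: complement the one-component union on the empty set.
sc-suc : ∀ {k} G → SC k G → SC (suc k) G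
sc-suc G s = sc-step G G [] s [] (λ _ → false) (complement-empty G)

sc-mono : ∀ {k k'} G → k ≤′ k' → SC k G → SC k' G
sc-mono G (≤′-reflexive refl) s = s
sc-mono G (≤′-step k≤′k')     s = sc-suc G (sc-mono G k≤′k' s)

-- TM_d^m ⊆ SC_{dm(m+1)}; with no colours there are no tree-models at all.
tm→SC : ∀ d m G → TM d m G → SC (d * m * (m + 1)) G
tm→SC d zero    G M = ⊥-elim (¬Fin0 (TM.colour M (to (TM.leaves M) (someLeaf (TM.T M)))))
tm→SC d (suc m) G M = sc-mono G (≤⇒≤′ depth-≤) (model→SC (expand (TM.T M) , tm→model M))
  where
  open Stretch (gramDim (suc m))
  depth-≤ : stretch d ≤ d * suc m * (suc m + 1)
  depth-≤ = subst (stretch d ≤_) (sym (*-assoc d (suc m) (suc m + 1))) (stretch-bound _ (stretchFactor-≤ m) d)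

sc→TM : ∀ k G → SC k G → TM k (2 ^ k) G
sc→TM k G s = model→TM (proj₂ (sc→model s))

theorem3p6 : ((𝒢 : Graph → Set) →
               ((Σ ℕ λ d → Σ ℕ λ m → ∀ G → 𝒢 G → TM d m G)
                 ⇔ (Σ ℕ λ k → ∀ G → 𝒢 G → SC k G)))
             × (∀ d m G → TM d m G → SC (d * m * (m + 1)) G)
             × (∀ k G → SC k G → TM k (2 ^ k) G)
theorem3p6 = classes , tm→SC , sc→TM
  where
  classes : (𝒢 : Graph → Set) →
            (Σ ℕ λ d → Σ ℕ λ m → ∀ G → 𝒢 G → TM d m G) ⇔ (Σ ℕ λ k → ∀ G → 𝒢 G → SC k G)
  classes 𝒢 = mk⇔ (λ (d , m , inTM) → d * m * (m + 1) , λ G G∈𝒢 → tm→SC d m G (inTM G G∈𝒢))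
                  (λ (k , inSC) → k , 2 ^ k , λ G G∈𝒢 → sc→TM k G (inSC G G∈𝒢))
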